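{- For every integer $l\geq 4$, there is no subset $A\subset V(P(2l,2))$ with $|A|=2l$ such that the number of edges of $P(2l,2)$ joining a vertex of $A$ to a vertex of $V(P(2l,2))\setminus A$ equals $4$.
   Context: For $n \geq 3$, $k \geq 1$ with $2k<n$, the generalized Petersen graph $P(n,k)$ has vertex set $\{u_i, v_i : i=0,1,\dots,n-1\}$ and edge set $\{u_iu_{i+1},\ u_iv_i,\ v_iv_{i+k} : i=0,\dots,n-1\}$, subscripts read modulo $n$. -}

module Defs where

open import Data.Nat using (ℕ; suc; _+_; _*_; _<_; NonZero)
open import Data.Nat.DivMod using (_%_)
open import Data.Fin using (Fin; toℕ; fromℕ<)
open import Data.Nat.DivMod using (m%n<n)
open import Data.Bool using (Bool; true; false; if_then_else_; _xor_)
open import Data.Product using (_×_; _,_)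
open import Data.List using (List; []; _∷_; _++_; concatMap; length; filter; allFin; map)
open import Data.Bool.Properties using (T?)
open import Data.Fin using () renaming (_≟_ to _≟F_)

-- Vertices of the generalized Petersen graph P(n,k):
-- (false , i) is u_i (outer), (true , i) is v_i (inner).
Vertex : ℕ → Set
Vertex n = Bool × Fin n

u : ∀ {n} → Fin n → Vertex n
u i = false , i

v : ∀ {n} → Fin n → Vertex n
v i = true , i

_⊕_ : ∀ {n} → Fin n → ℕ → Fin n
_⊕_ {suc m} i j = fromℕ< (m%n<n (toℕ i + j) (suc m))

-- Under the standing hypotheses n ≥ 3, 2k < n these 3n edges are pairwise distinct,
-- so this list enumerates E(P(n,k)) without repetition.
edges : (n k : ℕ) → List (Vertex n × Vertex n)
edges n k = concatMap (λ i → (u i , u (i ⊕ 1)) ∷ (u i , v i) ∷ (v i , v (i ⊕ k)) ∷ []) (allFin n)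

vertices : (n : ℕ) → List (Vertex n)
vertices n = map u (allFin n) ++ map v (allFin n)

VSubset : ℕ → Set
VSubset n = Vertex n → Bool

card : ∀ {n} → VSubset n → ℕ
card {n} A = length (filter (λ x → T? (A x)) (vertices n))

cutSize : (n k : ℕ) → VSubset n → ℕ
cutSize n k A = length (filter (λ e → T? (A (Data.Product.proj₁ e) xor A (Data.Product.proj₂ e))) (edges n k))

-- Encode A by the Boolean sequences x i = [u_i ∈ A] and y i = [v_i ∈ A], indices mod n = 2l.
-- The cut then splits as o + s + e + d: o changes of x along the outer n-cycle, s spokes on
-- which x and y disagree, and e, d changes of y along the two inner l-cycles (even and odd
-- indices).  Along a cycle the number of changes is even, so o, e, d are each 0 or at least 2.
-- If o = 0, x is constant and |A| = n forces s = n > 4.  If e = d = 0, y is constant on each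
-- parity class: either y is constant (s = n again) or y alternates, and then
-- s_i + o_i + s_(i+1) ≥ 1 for every i, so n ≤ 2s + o, forcing o = 0.  Otherwise o = 2, s = 0
-- and one inner cycle is uncut; then x = y is constant on one parity class with a single
-- exception on the other, so |A| = 2 |x| ∈ {2, 2n - 2}, which is not n.

module Submission where

open import Data.Bool using (Bool; true; false; not; _xor_)
open import Data.Bool.Properties using (T?; xor-comm; xor-same) renaming (_≟_ to _≟ᵇ_)
open import Data.Empty using (⊥)
import Data.Fin as Fin
open Fin using (Fin; toℕ)
open import Data.Fin.Properties using (fromℕ<-cong; fromℕ<-toℕ; toℕ<n)
open import Data.List using (List; []; _∷_; _++_; map; concatMap; length; filter; tabulate; allFin)
open import Data.List.Properties using (map-++; map-tabulate; map-∘)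
open import Data.Nat using (ℕ; zero; suc; _+_; _*_; _≤_; _<_; z≤n; s≤s; parity)
open import Data.Nat.DivMod using (_mod_; m%n<n; [m+n]%n≡m%n; m<n⇒m%n≡m)
open import Data.Nat.ListAction using (sum)
open import Data.Nat.ListAction.Properties using (sum-++)
open import Data.Nat.Properties
open import Algebra.Properties.CommutativeSemigroup +-commutativeSemigroup using (interchange)
open import Data.Parity.Base as ℙ using ()
open import Data.Parity.Properties using (+-homo-+)
open import Data.Product using (_×_; _,_; proj₁; proj₂)
open import Data.Sum using (_⊎_; inj₁; inj₂)
open import Function using (_∘_; id)
open import Relation.Binary.PropositionalEquality
open import Relation.Nullary using (¬_; Dec; yes; no; contradiction)
open import Defs

χ : Bool → ℕ
χ false = 0
χ true  = 1

∑< : ℕ → (ℕ → ℕ) → ℕ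
∑< zero    f = 0
∑< (suc n) f = ∑< n f + f n

syntax ∑< n (λ i → e) = ∑[ i < n ] e

∑<-cong : ∀ n {f g : ℕ → ℕ} → (∀ i → i < n → f i ≡ g i) → ∑< n f ≡ ∑< n g
∑<-cong zero    _  = refl
∑<-cong (suc n) eq = cong₂ _+_ (∑<-cong n (λ i i<n → eq i (m<n⇒m<1+n i<n))) (eq n ≤-refl)

∑<-mono-≤ : ∀ n {f g : ℕ → ℕ} → (∀ i → i < n → f i ≤ g i) → ∑< n f ≤ ∑< n g
∑<-mono-≤ zero    _  = z≤n
∑<-mono-≤ (suc n) le = +-mono-≤ (∑<-mono-≤ n (λ i i<n → le i (m<n⇒m<1+n i<n))) (le n ≤-refl)

∑<-distrib-+ : ∀ n (f g : ℕ → ℕ) → ∑[ i < n ] (f i + g i) ≡ ∑< n f + ∑< n g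
∑<-distrib-+ zero    f g = refl
∑<-distrib-+ (suc n) f g =
  trans (cong (_+ (f n + g n)) (∑<-distrib-+ n f g)) (interchange (∑< n f) (∑< n g) (f n) (g n))

∑<-const : ∀ n c → ∑< n (λ _ → c) ≡ n * c
∑<-const zero    c = refl
∑<-const (suc n) c = trans (cong (_+ c) (∑<-const n c)) (+-comm (n * c) c)

∑<-≡0 : ∀ n {f : ℕ → ℕ} → ∑< n f ≡ 0 → ∀ i → i < n → f i ≡ 0
∑<-≡0 (suc n) sum≡0 i i<1+n with m<1+n⇒m<n∨m≡n i<1+n
... | inj₁ i<n  = ∑<-≡0 n (m+n≡0⇒m≡0 _ sum≡0) i i<n
... | inj₂ refl = m+n≡0⇒n≡0 _ sum≡0

∑<-suc : ∀ n (f : ℕ → ℕ) → ∑< (suc n) f ≡ f 0 + ∑< n (f ∘ suc)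
∑<-suc zero    f = +-comm 0 (f 0)
∑<-suc (suc n) f = trans (cong (_+ f (suc n)) (∑<-suc n f)) (+-assoc (f 0) _ _)

∑<-rotate : ∀ n (f : ℕ → ℕ) → f n ≡ f 0 → ∑< n (f ∘ suc) ≡ ∑< n f
∑<-rotate n f fn≡f0 = +-cancelˡ-≡ (f 0) _ _ (begin
  f 0 + ∑< n (f ∘ suc)  ≡⟨ ∑<-suc n f ⟨
  ∑< n f + f n          ≡⟨ cong (∑< n f +_) fn≡f0 ⟩
  ∑< n f + f 0          ≡⟨ +-comm (∑< n f) (f 0) ⟩
  f 0 + ∑< n f          ∎)
  where open ≡-Reasoning

∑<-double : ∀ l (f : ℕ → ℕ) → ∑< (2 * l) f ≡ ∑[ j < l ] (f (2 * j) + f (suc (2 * j)))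
∑<-double zero    f = refl
∑<-double (suc l) f = begin
  ∑< (2 * suc l) f                               ≡⟨ cong (λ m → ∑< m f) (*-suc 2 l) ⟩
  ∑< (2 * l) f + f (2 * l) + f (suc (2 * l))     ≡⟨ +-assoc (∑< (2 * l) f) _ _ ⟩
  ∑< (2 * l) f + (f (2 * l) + f (suc (2 * l)))   ≡⟨ cong (_+ (f (2 * l) + f (suc (2 * l)))) (∑<-double l f) ⟩
  ∑[ j < suc l ] (f (2 * j) + f (suc (2 * j)))   ∎
  where open ≡-Reasoning

∀<-double : ∀ l {P : ℕ → Set} → (∀ j → j < l → P (2 * j) × P (suc (2 * j))) →
  ∀ i → i < 2 * l → P i
∀<-double (suc l) {P} h i i<2+2l with m<1+n⇒m<n∨m≡n (subst (i <_) (*-suc 2 l) i<2+2l)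
... | inj₂ refl = proj₂ (h l ≤-refl)
... | inj₁ i<1+2l with m<1+n⇒m<n∨m≡n i<1+2l
...   | inj₂ refl = proj₁ (h l ≤-refl)
...   | inj₁ i<2l = ∀<-double l {P} (λ j j<l → h j (m<n⇒m<1+n j<l)) i i<2l

χ-xor≡0⇒≡ : ∀ a b → χ (a xor b) ≡ 0 → a ≡ b
χ-xor≡0⇒≡ false false _ = refl
χ-xor≡0⇒≡ true  true  _ = refl

cong-χ-xor : ∀ {a a′ b b′} → a ≡ a′ → b ≡ b′ → χ (a xor b) ≡ χ (a′ xor b′)
cong-χ-xor = cong₂ (λ a b → χ (a xor b))

Periodic : ℕ → (ℕ → Bool) → Set
Periodic n z = ∀ i → z (i + n) ≡ z i

changes : (ℕ → Bool) → ℕ → ℕ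
changes z m = ∑[ i < m ] χ (z i xor z (suc i))

weight : (ℕ → Bool) → ℕ → ℕ
weight z n = ∑[ i < n ] χ (z i)

disagreements : (ℕ → Bool) → (ℕ → Bool) → ℕ → ℕ
disagreements x y n = ∑[ i < n ] χ (x i xor y i)

evens odds : (ℕ → Bool) → ℕ → Bool
evens z j = z (2 * j)
odds  z j = z (suc (2 * j))

parity-χ-xor : ∀ a b c → parity (χ (a xor b)) ℙ.+ parity (χ (b xor c)) ≡ parity (χ (a xor c))
parity-χ-xor false false c     = refl
parity-χ-xor false true  false = refl
parity-χ-xor false true  true  = refl
parity-χ-xor true  false false = refl
parity-χ-xor true  false true  = refl
parity-χ-xor true  true  c     = refl

changes-parity : ∀ z m → parity (changes z m) ≡ parity (χ (z 0 xor z m))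
changes-parity z zero    = cong (parity ∘ χ) (sym (xor-same (z 0)))
changes-parity z (suc m) = begin
  parity (changes z m + χ (z m xor z (suc m)))                 ≡⟨ +-homo-+ (changes z m) _ ⟩
  parity (changes z m) ℙ.+ parity (χ (z m xor z (suc m)))
    ≡⟨ cong (ℙ._+ parity (χ (z m xor z (suc m)))) (changes-parity z m) ⟩
  parity (χ (z 0 xor z m)) ℙ.+ parity (χ (z m xor z (suc m)))  ≡⟨ parity-χ-xor (z 0) (z m) (z (suc m)) ⟩
  parity (χ (z 0 xor z (suc m)))                               ∎
  where open ≡-Reasoning

changes≢1 : ∀ z m → z m ≡ z 0 → changes z m ≢ 1
changes≢1 z m closed changes≡1 = 1ℙ≢0ℙ (begin
  ℙ.1ℙ                      ≡⟨ cong parity changes≡1 ⟨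
  parity (changes z m)      ≡⟨ changes-parity z m ⟩
  parity (χ (z 0 xor z m))  ≡⟨ cong (λ b → parity (χ (z 0 xor b))) closed ⟩
  parity (χ (z 0 xor z 0))  ≡⟨ cong (parity ∘ χ) (xor-same (z 0)) ⟩
  ℙ.0ℙ                      ∎)
  where
  open ≡-Reasoning
  1ℙ≢0ℙ : ℙ.1ℙ ≢ ℙ.0ℙ
  1ℙ≢0ℙ ()

changes≢0⇒2≤ : ∀ z m → z m ≡ z 0 → changes z m ≢ 0 → 2 ≤ changes z m
changes≢0⇒2≤ z m closed ≢0 = ≢0∧≢1⇒2≤ ≢0 (changes≢1 z m closed)
  where
  ≢0∧≢1⇒2≤ : ∀ {c} → c ≢ 0 → c ≢ 1 → 2 ≤ c
  ≢0∧≢1⇒2≤ {zero}        c≢0 _   = contradiction refl c≢0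
  ≢0∧≢1⇒2≤ {suc zero}    _   c≢1 = contradiction refl c≢1
  ≢0∧≢1⇒2≤ {suc (suc c)} _   _   = s≤s (s≤s z≤n)

changes≡0⇒constant : ∀ z m → changes z m ≡ 0 → ∀ t → t ≤ m → z t ≡ z 0
changes≡0⇒constant z m none zero    _   = refl
changes≡0⇒constant z m none (suc t) t<m =
  trans (sym (χ-xor≡0⇒≡ (z t) (z (suc t)) (∑<-≡0 m none t t<m)))
        (changes≡0⇒constant z m none t (<⇒≤ t<m))

disagreements-comm : ∀ n x y → disagreements x y n ≡ disagreements y x n
disagreements-comm n x y = ∑<-cong n (λ i _ → cong χ (xor-comm (x i) (y i)))

weight-constant : ∀ n z q → (∀ i → i < n → z i ≡ q) → weight z n ≡ n * χ q
weight-constant n z q const = trans (∑<-cong n (λ i i<n → cong χ (const i i<n))) (∑<-const n (χ q))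

weight-not : ∀ n z → weight (not ∘ z) n + weight z n ≡ n
weight-not n z = begin
  weight (not ∘ z) n + weight z n       ≡⟨ ∑<-distrib-+ n (χ ∘ not ∘ z) (χ ∘ z) ⟨
  ∑[ i < n ] (χ (not (z i)) + χ (z i))  ≡⟨ ∑<-cong n (λ i _ → χ-not+χ (z i)) ⟩
  ∑< n (λ _ → 1)                        ≡⟨ ∑<-const n 1 ⟩
  n * 1                                 ≡⟨ *-identityʳ n ⟩
  n                                     ∎
  where
  open ≡-Reasoning
  χ-not+χ : ∀ b → χ (not b) + χ b ≡ 1
  χ-not+χ false = refl
  χ-not+χ true  = refl

disagreements-constant : ∀ n x y q → (∀ i → i < n → x i ≡ q) →
  weight x n + weight y n ≡ n → disagreements x y n ≡ n
disagreements-constant n x y false const balanced = begin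
  disagreements x y n      ≡⟨ ∑<-cong n (λ i i<n → cong (λ b → χ (b xor y i)) (const i i<n)) ⟩
  weight y n               ≡⟨ cong (_+ weight y n) (trans (weight-constant n x false const) (*-zeroʳ n)) ⟨
  weight x n + weight y n  ≡⟨ balanced ⟩
  n                        ∎
  where open ≡-Reasoning
disagreements-constant n x y true const balanced = begin
  disagreements x y n  ≡⟨ ∑<-cong n (λ i i<n → cong-χ-xor (const i i<n) (y≡false i i<n)) ⟩
  ∑< n (λ _ → 1)       ≡⟨ ∑<-const n 1 ⟩
  n * 1                ≡⟨ *-identityʳ n ⟩
  n                    ∎
  where
  open ≡-Reasoning
  weight-y≡0 : weight y n ≡ 0
  weight-y≡0 = +-cancelˡ-≡ n _ _ (begin
    n + weight y n           ≡⟨ cong (_+ weight y n) (trans (weight-constant n x true const) (*-identityʳ n)) ⟨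
    weight x n + weight y n  ≡⟨ balanced ⟩
    n                        ≡⟨ +-identityʳ n ⟨
    n + 0                    ∎)
  y≡false : ∀ i → i < n → y i ≡ false
  y≡false i i<n = sym (χ-xor≡0⇒≡ false (y i) (∑<-≡0 n weight-y≡0 i i<n))

hamming-path : ∀ a b c d → b ≢ d → 1 ≤ χ (a xor b) + χ (a xor c) + χ (c xor d)
hamming-path _     false _     false b≢d = contradiction refl b≢d
hamming-path _     true  _     true  b≢d = contradiction refl b≢d
hamming-path false false false true  _   = s≤s z≤n
hamming-path false false true  true  _   = s≤s z≤n
hamming-path true  false false true  _   = s≤s z≤n
hamming-path true  false true  true  _   = s≤s z≤n
hamming-path false true  false false _   = s≤s z≤n
hamming-path false true  true  false _   = s≤s z≤n
hamming-path true  true  false false _   = s≤s z≤n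
hamming-path true  true  true  false _   = s≤s z≤n

alternating⇒n≤disagreements+changes+disagreements : ∀ n x y → x n ≡ x 0 → y n ≡ y 0 →
  (∀ i → i < n → y i ≢ y (suc i)) → n ≤ disagreements x y n + changes x n + disagreements x y n
alternating⇒n≤disagreements+changes+disagreements n x y x-closed y-closed alternating = begin
  n                                                 ≡⟨ *-identityʳ n ⟨
  n * 1                                             ≡⟨ ∑<-const n 1 ⟨
  ∑< n (λ _ → 1)                                    ≤⟨ ∑<-mono-≤ n path ⟩
  ∑[ i < n ] (spoke i + outer i + spoke (suc i))
    ≡⟨ ∑<-distrib-+ n (λ i → spoke i + outer i) (spoke ∘ suc) ⟩
  ∑[ i < n ] (spoke i + outer i) + ∑< n (spoke ∘ suc)
    ≡⟨ cong₂ _+_ (∑<-distrib-+ n spoke outer) (∑<-rotate n spoke (cong-χ-xor x-closed y-closed)) ⟩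
  disagreements x y n + changes x n + disagreements x y n ∎
  where
  open ≤-Reasoning
  spoke outer : ℕ → ℕ
  spoke i = χ (x i xor y i)
  outer i = χ (x i xor x (suc i))
  path : ∀ i → i < n → 1 ≤ spoke i + outer i + spoke (suc i)
  path i i<n = hamming-path (x i) (y i) (x (suc i)) (y (suc i)) (alternating i i<n)

changes-evens-constant : ∀ l z q → (∀ j → j ≤ l → evens z j ≡ q) →
  changes z (2 * l) ≡ 2 * ∑[ j < l ] χ (q xor odds z j)
changes-evens-constant l z q even = begin
  changes z (2 * l)
    ≡⟨ ∑<-double l (λ i → χ (z i xor z (suc i))) ⟩
  ∑[ j < l ] (χ (evens z j xor odds z j) + χ (odds z j xor z (2 + 2 * j)))
    ≡⟨ ∑<-cong l (λ j j<l → cong₂ _+_ (left j j<l) (right j j<l)) ⟩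
  ∑[ j < l ] (k j + k j)   ≡⟨ ∑<-distrib-+ l k k ⟩
  ∑< l k + ∑< l k          ≡⟨ cong (∑< l k +_) (+-identityʳ (∑< l k)) ⟨
  2 * ∑< l k               ∎
  where
  open ≡-Reasoning
  k : ℕ → ℕ
  k j = χ (q xor odds z j)
  left : ∀ j → j < l → χ (evens z j xor odds z j) ≡ k j
  left j j<l = cong (λ b → χ (b xor odds z j)) (even j (<⇒≤ j<l))
  right : ∀ j → j < l → χ (odds z j xor z (2 + 2 * j)) ≡ k j
  right j j<l = begin
    χ (odds z j xor z (2 + 2 * j))
      ≡⟨ cong (λ b → χ (odds z j xor b)) (trans (cong z (sym (*-suc 2 j))) (even (suc j) j<l)) ⟩
    χ (odds z j xor q)              ≡⟨ cong χ (xor-comm (odds z j) q) ⟩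
    k j                             ∎

weight-evens-constant : ∀ l z q → (∀ j → j ≤ l → evens z j ≡ q) →
  weight z (2 * l) ≡ l * χ q + weight (odds z) l
weight-evens-constant l z q even = begin
  weight z (2 * l)                             ≡⟨ ∑<-double l (χ ∘ z) ⟩
  ∑[ j < l ] (χ (evens z j) + χ (odds z j))    ≡⟨ ∑<-distrib-+ l (χ ∘ evens z) (χ ∘ odds z) ⟩
  weight (evens z) l + weight (odds z) l
    ≡⟨ cong (_+ weight (odds z) l) (weight-constant l (evens z) q (λ j j<l → even j (<⇒≤ j<l))) ⟩
  l * χ q + weight (odds z) l                  ∎
  where open ≡-Reasoning

evens-constant⇒weight≢half : ∀ l z q → 2 ≤ l → (∀ j → j ≤ l → evens z j ≡ q) →
  changes z (2 * l) ≡ 2 → weight z (2 * l) ≢ l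
evens-constant⇒weight≢half l z q 2≤l even two-changes half with q
... | false = <⇒≢ 2≤l (begin
  1                                ≡⟨ one-odd-off ⟨
  weight (odds z) l                ≡⟨ cong (_+ weight (odds z) l) (*-zeroʳ l) ⟨
  l * 0 + weight (odds z) l        ≡⟨ weight-evens-constant l z false even ⟨
  weight z (2 * l)                 ≡⟨ half ⟩
  l                                ∎)
  where
  open ≡-Reasoning
  one-odd-off : weight (odds z) l ≡ 1
  one-odd-off = *-cancelˡ-≡ _ 1 2 (trans (sym (changes-evens-constant l z false even)) two-changes)
... | true = <⇒≢ 2≤l (begin
  1                                            ≡⟨ cong₂ _+_ one-odd-off no-odd-on ⟨
  weight (not ∘ odds z) l + weight (odds z) l  ≡⟨ weight-not l (odds z) ⟩
  l                                            ∎)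
  where
  open ≡-Reasoning
  one-odd-off : weight (not ∘ odds z) l ≡ 1
  one-odd-off = *-cancelˡ-≡ _ 1 2 (trans (sym (changes-evens-constant l z true even)) two-changes)
  no-odd-on : weight (odds z) l ≡ 0
  no-odd-on = +-cancelˡ-≡ l _ _ (begin
    l + weight (odds z) l      ≡⟨ cong (_+ weight (odds z) l) (*-identityʳ l) ⟨
    l * 1 + weight (odds z) l  ≡⟨ weight-evens-constant l z true even ⟨
    weight z (2 * l)           ≡⟨ half ⟩
    l                          ≡⟨ +-identityʳ l ⟨
    l + 0                      ∎)

spokes-and-evens-uncut⇒unbalanced : ∀ l x y → 2 ≤ l → x (2 * l) ≡ x 0 → y (2 * l) ≡ y 0 →
  disagreements x y (2 * l) ≡ 0 → changes (evens y) l ≡ 0 → changes x (2 * l) ≡ 2 →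
  weight x (2 * l) + weight y (2 * l) ≢ 2 * l
spokes-and-evens-uncut⇒unbalanced l x y 2≤l x-closed y-closed no-spokes evens-uncut two-changes balanced =
  evens-constant⇒weight≢half l y (y 0) 2≤l (changes≡0⇒constant (evens y) l evens-uncut)
    (trans (sym changes-x≡changes-y) two-changes)
    weight-y≡l
  where
  n = 2 * l
  x≡y : ∀ i → i < n → x i ≡ y i
  x≡y i i<n = χ-xor≡0⇒≡ (x i) (y i) (∑<-≡0 n no-spokes i i<n)
  x≡y-closed : ∀ i → i ≤ n → x i ≡ y i
  x≡y-closed i i≤n with m≤n⇒m<n∨m≡n i≤n
  ... | inj₁ i<n  = x≡y i i<n
  ... | inj₂ refl = trans x-closed (trans (x≡y 0 0<n) (sym y-closed))
    where
    0<n : 0 < n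
    0<n = ≤-trans (≤-trans (s≤s z≤n) 2≤l) (m≤m+n l (l + 0))
  changes-x≡changes-y : changes x n ≡ changes y n
  changes-x≡changes-y = ∑<-cong n (λ i i<n → cong-χ-xor (x≡y i i<n) (x≡y-closed (suc i) i<n))
  weight-x≡weight-y : weight x n ≡ weight y n
  weight-x≡weight-y = ∑<-cong n (λ i i<n → cong χ (x≡y i i<n))
  weight-y≡l : weight y n ≡ l
  weight-y≡l = *-cancelˡ-≡ (weight y n) l 2 (begin
    weight y n + (weight y n + 0)  ≡⟨ cong (weight y n +_) (+-identityʳ (weight y n)) ⟩
    weight y n + weight y n        ≡⟨ cong (_+ weight y n) weight-x≡weight-y ⟨
    weight x n + weight y n        ≡⟨ balanced ⟩
    2 * l                          ∎)
    where open ≡-Reasoning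

-- Rotating the indices by one exchanges the even and the odd inner cycle.
spokes-and-odds-uncut⇒unbalanced : ∀ l x y → 2 ≤ l → Periodic (2 * l) x → Periodic (2 * l) y →
  disagreements x y (2 * l) ≡ 0 → changes (odds y) l ≡ 0 → changes x (2 * l) ≡ 2 →
  weight x (2 * l) + weight y (2 * l) ≢ 2 * l
spokes-and-odds-uncut⇒unbalanced l x y 2≤l x-periodic y-periodic no-spokes odds-uncut two-changes balanced =
  spokes-and-evens-uncut⇒unbalanced l (x ∘ suc) (y ∘ suc) 2≤l (x-periodic 1) (y-periodic 1)
    (trans (rotate (λ i → χ (x i xor y i)) (cong-χ-xor (x-periodic 0) (y-periodic 0))) no-spokes)
    odds-uncut
    (trans (rotate (λ i → χ (x i xor x (suc i))) (cong-χ-xor (x-periodic 0) (x-periodic 1))) two-changes)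
    (trans (cong₂ _+_ (rotate (χ ∘ x) (cong χ (x-periodic 0))) (rotate (χ ∘ y) (cong χ (y-periodic 0))))
           balanced)
  where
  rotate : ∀ (f : ℕ → ℕ) → f (2 * l) ≡ f 0 → ∑< (2 * l) (f ∘ suc) ≡ ∑< (2 * l) f
  rotate = ∑<-rotate (2 * l)

classwise-constant⇒many-disagreements : ∀ l x y p q → x (2 * l) ≡ x 0 → y (2 * l) ≡ y 0 →
  (∀ j → j ≤ l → y (2 * j) ≡ p) → (∀ j → j ≤ l → y (suc (2 * j)) ≡ q) →
  weight x (2 * l) + weight y (2 * l) ≡ 2 * l →
  disagreements x y (2 * l) ≡ 2 * l
    ⊎ 2 * l ≤ disagreements x y (2 * l) + changes x (2 * l) + disagreements x y (2 * l)
classwise-constant⇒many-disagreements l x y p q x-closed y-closed even odd balanced with p ≟ᵇ q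
... | yes refl = inj₁ (trans (disagreements-comm (2 * l) x y)
                             (disagreements-constant (2 * l) y x p constant
                               (trans (+-comm (weight y (2 * l)) (weight x (2 * l))) balanced)))
  where
  constant : ∀ i → i < 2 * l → y i ≡ p
  constant = ∀<-double l (λ j j<l → even j (<⇒≤ j<l) , odd j (<⇒≤ j<l))
... | no p≢q =
  inj₂ (alternating⇒n≤disagreements+changes+disagreements (2 * l) x y x-closed y-closed alternating)
  where
  alternating : ∀ i → i < 2 * l → y i ≢ y (suc i)
  alternating = ∀<-double l (λ j j<l →
      (λ eq → p≢q (trans (sym (even j (<⇒≤ j<l))) (trans eq (odd j (<⇒≤ j<l)))))
    , (λ eq → p≢q (trans (sym (even (suc j) j<l))
                          (trans (cong y (*-suc 2 j)) (trans (sym eq) (odd j (<⇒≤ j<l)))))))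

-- The summand at i counts the cut edges among u_i u_(i+1), u_i v_i and v_i v_(i+k) of P(n,k).
petersenCut : ℕ → ℕ → (ℕ → Bool) → (ℕ → Bool) → ℕ
petersenCut n k x y = ∑[ i < n ] (χ (x i xor x (suc i)) + χ (x i xor y i) + χ (y i xor y (k + i)))

petersenCut-split : ∀ l x y → petersenCut (2 * l) 2 x y ≡
  changes x (2 * l) + disagreements x y (2 * l) + (changes (evens y) l + changes (odds y) l)
petersenCut-split l x y = begin
  petersenCut (2 * l) 2 x y
    ≡⟨ ∑<-distrib-+ (2 * l) (λ i → outer i + spoke i) inner ⟩
  ∑[ i < 2 * l ] (outer i + spoke i) + ∑< (2 * l) inner
    ≡⟨ cong₂ _+_ (∑<-distrib-+ (2 * l) outer spoke) (∑<-double l inner) ⟩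
  changes x (2 * l) + disagreements x y (2 * l) + ∑[ j < l ] (inner (2 * j) + inner (suc (2 * j)))
    ≡⟨ cong (changes x (2 * l) + disagreements x y (2 * l) +_)
            (trans (∑<-cong l by-class) (∑<-distrib-+ l _ _)) ⟩
  changes x (2 * l) + disagreements x y (2 * l) + (changes (evens y) l + changes (odds y) l) ∎
  where
  open ≡-Reasoning
  outer spoke inner : ℕ → ℕ
  outer i = χ (x i xor x (suc i))
  spoke i = χ (x i xor y i)
  inner i = χ (y i xor y (2 + i))
  by-class : ∀ j → j < l → inner (2 * j) + inner (suc (2 * j))
                         ≡ χ (evens y j xor evens y (suc j)) + χ (odds y j xor odds y (suc j))
  by-class j _ = cong₂ _+_ (cong (λ m → χ (y (2 * j) xor y m)) (sym (*-suc 2 j)))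
                           (cong (λ m → χ (y (suc (2 * j)) xor y (suc m))) (sym (*-suc 2 j)))

two-twos-exhaust-4 : ∀ {o s e d} → o + s + (e + d) ≡ 4 → 2 ≤ o → 2 ≤ d → o ≡ 2 × s ≡ 0 × e ≡ 0
two-twos-exhaust-4 {suc (suc o)} {s} {e} {suc (suc d)} sum≡4 (s≤s (s≤s _)) (s≤s (s≤s _)) =
  cong (2 +_) (m+n≡0⇒m≡0 o o+s≡0) , m+n≡0⇒n≡0 o o+s≡0 ,
  m+n≡0⇒m≡0 e (m+n≡0⇒n≡0 (o + s) rest≡0)
  where
  rest≡0 : o + s + (e + d) ≡ 0
  rest≡0 = +-cancelˡ-≡ 4 _ 0 (trans (cong (suc ∘ suc) (sym (begin
    o + s + (e + suc (suc d))    ≡⟨ cong (o + s +_) (trans (+-suc e (suc d)) (cong suc (+-suc e d))) ⟩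
    o + s + suc (suc (e + d))    ≡⟨ +-suc (o + s) (suc (e + d)) ⟩
    suc (o + s + suc (e + d))    ≡⟨ cong suc (+-suc (o + s) (e + d)) ⟩
    suc (suc (o + s + (e + d)))  ∎))) sum≡4)
    where open ≡-Reasoning
  o+s≡0 : o + s ≡ 0
  o+s≡0 = m+n≡0⇒m≡0 (o + s) rest≡0

m+n≡4∧8≤n+m+n⇒m≡0 : ∀ {m n} → m + n ≡ 4 → 8 ≤ n + m + n → m ≡ 0
m+n≡4∧8≤n+m+n⇒m≡0 {m} {n} m+n≡4 8≤n+m+n = n≤0⇒n≡0 (+-cancelʳ-≤ 4 m 0 (begin
  m + 4  ≤⟨ +-monoʳ-≤ m 4≤n ⟩
  m + n  ≡⟨ m+n≡4 ⟩
  4      ∎))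
  where
  open ≤-Reasoning
  4≤n : 4 ≤ n
  4≤n = +-cancelˡ-≤ 4 4 n (begin
    8              ≤⟨ 8≤n+m+n ⟩
    n + m + n      ≡⟨ cong (_+ n) (trans (+-comm n m) m+n≡4) ⟩
    4 + n          ∎)

no-balanced-4-cut : ∀ l x y → 4 ≤ l → Periodic (2 * l) x → Periodic (2 * l) y →
  weight x (2 * l) + weight y (2 * l) ≡ 2 * l → petersenCut (2 * l) 2 x y ≢ 4
no-balanced-4-cut l x y 4≤l x-periodic y-periodic balanced cut≡4 = by-cases (e ≟ 0) (d ≟ 0)
  where
  n = 2 * l
  o = changes x n
  s = disagreements x y n
  e = changes (evens y) l
  d = changes (odds y) l

  o+s+[e+d]≡4 : o + s + (e + d) ≡ 4
  o+s+[e+d]≡4 = trans (sym (petersenCut-split l x y)) cut≡4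

  2≤l : 2 ≤ l
  2≤l = ≤-trans (s≤s (s≤s z≤n)) 4≤l

  8≤n : 8 ≤ n
  8≤n = *-monoʳ-≤ 2 4≤l

  s≢n : s ≢ n
  s≢n s≡n = <⇒≱ (≤-trans (s≤s (s≤s (s≤s (s≤s (s≤s z≤n))))) 8≤n) (begin
    n                ≡⟨ s≡n ⟨
    s                ≤⟨ m≤n+m s o ⟩
    o + s            ≤⟨ m≤m+n (o + s) (e + d) ⟩
    o + s + (e + d)  ≡⟨ o+s+[e+d]≡4 ⟩
    4                ∎)
    where open ≤-Reasoning

  o≢0 : o ≢ 0
  o≢0 o≡0 = s≢n (disagreements-constant n x y (x 0)
                   (λ i i<n → changes≡0⇒constant x n o≡0 i (<⇒≤ i<n)) balanced)

  2≤o : 2 ≤ o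
  2≤o = changes≢0⇒2≤ x n (x-periodic 0) o≢0

  by-cases : Dec (e ≡ 0) → Dec (d ≡ 0) → ⊥
  by-cases (yes e≡0) (yes d≡0)
    with classwise-constant⇒many-disagreements l x y (y 0) (y 1) (x-periodic 0) (y-periodic 0)
           (changes≡0⇒constant (evens y) l e≡0) (changes≡0⇒constant (odds y) l d≡0) balanced
  ... | inj₁ s≡n       = s≢n s≡n
  ... | inj₂ n≤s+o+s = o≢0 (m+n≡4∧8≤n+m+n⇒m≡0 o+s≡4 (≤-trans 8≤n n≤s+o+s))
    where
    o+s≡4 : o + s ≡ 4
    o+s≡4 = trans (sym (+-identityʳ (o + s))) (trans (cong (o + s +_) (sym (cong₂ _+_ e≡0 d≡0))) o+s+[e+d]≡4)
  by-cases _ (no d≢0)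
    with two-twos-exhaust-4 o+s+[e+d]≡4 2≤o (changes≢0⇒2≤ (odds y) l (y-periodic 1) d≢0)
  ... | o≡2 , s≡0 , e≡0 =
    spokes-and-evens-uncut⇒unbalanced l x y 2≤l (x-periodic 0) (y-periodic 0) s≡0 e≡0 o≡2 balanced
  by-cases (no e≢0) _
    with two-twos-exhaust-4 (trans (cong (o + s +_) (+-comm d e)) o+s+[e+d]≡4) 2≤o
           (changes≢0⇒2≤ (evens y) l (y-periodic 0) e≢0)
  ... | o≡2 , s≡0 , d≡0 =
    spokes-and-odds-uncut⇒unbalanced l x y 2≤l x-periodic y-periodic s≡0 d≡0 o≡2 balanced

length-filter≡sum-χ : ∀ {X : Set} (h : X → Bool) xs →
  length (filter (λ e → T? (h e)) xs) ≡ sum (map (χ ∘ h) xs)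
length-filter≡sum-χ h []       = refl
length-filter≡sum-χ h (x ∷ xs) with h x
... | true  = cong suc (length-filter≡sum-χ h xs)
... | false = length-filter≡sum-χ h xs

sum-map-concatMap : ∀ {X Y : Set} (g : Y → ℕ) (f : X → List Y) xs →
  sum (map g (concatMap f xs)) ≡ sum (map (λ x → sum (map g (f x))) xs)
sum-map-concatMap g f []       = refl
sum-map-concatMap g f (x ∷ xs) = begin
  sum (map g (f x ++ concatMap f xs))               ≡⟨ cong sum (map-++ g (f x) (concatMap f xs)) ⟩
  sum (map g (f x) ++ map g (concatMap f xs))       ≡⟨ sum-++ (map g (f x)) (map g (concatMap f xs)) ⟩
  sum (map g (f x)) + sum (map g (concatMap f xs))  ≡⟨ cong (sum (map g (f x)) +_) (sum-map-concatMap g f xs) ⟩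
  sum (map (λ x → sum (map g (f x))) (x ∷ xs))      ∎
  where open ≡-Reasoning

sum-map-allFin : ∀ n (F : Fin n → ℕ) (G : ℕ → ℕ) → (∀ i → F i ≡ G (toℕ i)) →
  sum (map F (allFin n)) ≡ ∑< n G
sum-map-allFin n F G F≗G = trans (cong sum (map-tabulate id F)) (sum-tabulate n F G F≗G)
  where
  sum-tabulate : ∀ n (F : Fin n → ℕ) (G : ℕ → ℕ) → (∀ i → F i ≡ G (toℕ i)) →
    sum (tabulate F) ≡ ∑< n G
  sum-tabulate zero    F G _   = refl
  sum-tabulate (suc n) F G F≗G =
    trans (cong₂ _+_ (F≗G Fin.zero) (sum-tabulate n (F ∘ Fin.suc) (G ∘ suc) (F≗G ∘ Fin.suc)))
          (sym (∑<-suc n G))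

mod-toℕ : ∀ {m} (i : Fin (suc m)) → toℕ i mod suc m ≡ i
mod-toℕ {m} i = trans (fromℕ<-cong _ _ (m<n⇒m%n≡m (toℕ<n i)) (m%n<n (toℕ i) (suc m)) (toℕ<n i))
                      (fromℕ<-toℕ i (toℕ<n i))

mod-periodic : ∀ {m} i → (i + suc m) mod suc m ≡ i mod suc m
mod-periodic {m} i = fromℕ<-cong _ _ ([m+n]%n≡m%n i (suc m)) (m%n<n (i + suc m) (suc m)) (m%n<n i (suc m))

inOuter inInner : ∀ {m} → VSubset (suc m) → ℕ → Bool
inOuter {m} A i = A (u (i mod suc m))
inInner {m} A i = A (v (i mod suc m))

inOuter-periodic : ∀ {m} (A : VSubset (suc m)) → Periodic (suc m) (inOuter A)
inOuter-periodic A i = cong (A ∘ u) (mod-periodic i)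

inInner-periodic : ∀ {m} (A : VSubset (suc m)) → Periodic (suc m) (inInner A)
inInner-periodic A i = cong (A ∘ v) (mod-periodic i)

card≡weights : ∀ {m} (A : VSubset (suc m)) → card A ≡ weight (inOuter A) (suc m) + weight (inInner A) (suc m)
card≡weights {m} A = begin
  card A
    ≡⟨ length-filter≡sum-χ A (map u (allFin N) ++ map v (allFin N)) ⟩
  sum (map (χ ∘ A) (map u (allFin N) ++ map v (allFin N)))
    ≡⟨ cong sum (map-++ (χ ∘ A) (map u (allFin N)) (map v (allFin N))) ⟩
  sum (map (χ ∘ A) (map u (allFin N)) ++ map (χ ∘ A) (map v (allFin N)))
    ≡⟨ sum-++ (map (χ ∘ A) (map u (allFin N))) _ ⟩
  sum (map (χ ∘ A) (map u (allFin N))) + sum (map (χ ∘ A) (map v (allFin N)))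
    ≡⟨ cong₂ _+_ (side u) (side v) ⟩
  weight (inOuter A) N + weight (inInner A) N ∎
  where
  open ≡-Reasoning
  N = suc m
  side : (w : Fin N → Vertex N) → sum (map (χ ∘ A) (map w (allFin N))) ≡ ∑[ i < N ] χ (A (w (i mod N)))
  side w = trans (cong sum (sym (map-∘ (allFin N))))
                 (sum-map-allFin N (χ ∘ A ∘ w) _ (λ i → cong (χ ∘ A ∘ w) (sym (mod-toℕ i))))

cutSize≡petersenCut : ∀ {m} k (A : VSubset (suc m)) →
  cutSize (suc m) k A ≡ petersenCut (suc m) k (inOuter A) (inInner A)
cutSize≡petersenCut {m} k A = begin
  cutSize N k A
    ≡⟨ length-filter≡sum-χ crosses (edges N k) ⟩
  sum (map (χ ∘ crosses) (edges N k))
    ≡⟨ sum-map-concatMap (χ ∘ crosses) rungs (allFin N) ⟩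
  sum (map (λ i → sum (map (χ ∘ crosses) (rungs i))) (allFin N))
    ≡⟨ sum-map-allFin N _ _ per-index ⟩
  petersenCut N k x y
    ∎
  where
  open ≡-Reasoning
  N = suc m
  x y : ℕ → Bool
  x = inOuter A
  y = inInner A
  crosses : Vertex N × Vertex N → Bool
  crosses e = A (proj₁ e) xor A (proj₂ e)
  rungs : Fin N → List (Vertex N × Vertex N)
  rungs i = (u i , u (i ⊕ 1)) ∷ (u i , v i) ∷ (v i , v (i ⊕ k)) ∷ []
  sum-of-three : ∀ a b c → sum (a ∷ b ∷ c ∷ []) ≡ a + b + c
  sum-of-three a b c = trans (cong (λ t → a + (b + t)) (+-identityʳ c)) (sym (+-assoc a b c))
  x-at : ∀ i → A (u i) ≡ x (toℕ i)
  x-at i = cong (A ∘ u) (sym (mod-toℕ i))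
  y-at : ∀ i → A (v i) ≡ y (toℕ i)
  y-at i = cong (A ∘ v) (sym (mod-toℕ i))
  per-index : ∀ i → sum (map (χ ∘ crosses) (rungs i)) ≡
    χ (x (toℕ i) xor x (suc (toℕ i))) + χ (x (toℕ i) xor y (toℕ i)) + χ (y (toℕ i) xor y (k + toℕ i))
  per-index i =
    trans (sum-of-three (χ (A (u i) xor A (u (i ⊕ 1)))) (χ (A (u i) xor A (v i))) (χ (A (v i) xor A (v (i ⊕ k)))))
          (cong₂ _+_ (cong₂ _+_ (cong-χ-xor (x-at i) (cong x (+-comm (toℕ i) 1))) (cong-χ-xor (x-at i) (y-at i)))
                     (cong-χ-xor (y-at i) (cong y (+-comm (toℕ i) k))))

lemma4p11 : (l : ℕ) → 4 ≤ l → (A : VSubset (2 * l)) →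
    ¬ (card A ≡ 2 * l × cutSize (2 * l) 2 A ≡ 4)
lemma4p11 (suc l) 4≤l A (card≡2l , cut≡4) =
  no-balanced-4-cut (suc l) (inOuter A) (inInner A) 4≤l (inOuter-periodic A) (inInner-periodic A)
    (trans (sym (card≡weights A)) card≡2l) (trans (sym (cutSize≡petersenCut 2 A)) cut≡4)
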